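{- For every $n\ge1$, $\mathrm{Sort}_n(\mathfrak{s}_{\underline{32}1})=\mathrm{Av}_n(\underline{123},132)$.
   Context: A pattern is a permutation $\sigma$ in which some blocks of consecutive entries may be underlined; a sequence contains it if it has a subsequence order-isomorphic to $\sigma$ whose entries corresponding to a common underlined block are adjacent in the sequence (so $\underline{123}$ means three consecutive increasing entries). $\mathrm{Av}_n(\dots)$ is the set of $\tau\in\mathfrak S_n$ avoiding all listed patterns. Pattern-avoiding stack map $\mathfrak{s}_\sigma$: process input $\tau_1,\dots,\tau_n$ in order; when $\tau_i$ is next, while the stack is nonempty and the sequence formed by placing $\tau_i$ on top of the stack, read top to bottom, contains $\sigma$ (underlined entries adjacent in the stack), pop the top entry to the output; then push $\tau_i$; at the end pop all remaining entries top to bottom to the output. West's stack-sorting map $s$ pushes each input entry after popping all smaller stack entries to the output, emptying the stack at the end. $\mathrm{Sort}_n(\mathfrak{s}_\sigma)=\{\tau\in\mathfrak S_n: s(\mathfrak{s}_\sigma(\tau))=12\cdots n\}$. -}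

module Defs where

open import Data.Nat using (ℕ; zero; suc; _+_; _<_; _<?_; _≤_)
open import Data.Fin using (Fin; toℕ)
open import Data.List using (List; []; _∷_; _++_; concat; length; lookup; map; upTo)
open import Data.List.Membership.Propositional using (_∈_)
open import Data.List.Relation.Binary.Permutation.Propositional using (_↭_)
open import Data.Product using (Σ; _×_; _,_)
open import Data.Bool using (if_then_else_)
open import Relation.Nullary using (Dec; does; ¬_)
open import Relation.Binary.PropositionalEquality using (_≡_)

oneTo : ℕ → List ℕ
oneTo n = map suc (upTo n)

IsPerm : ℕ → List ℕ → Set
IsPerm n τ = τ ↭ oneTo n

-- Patterns: a permutation split into blocks of consecutive entries;
-- a block of length ≥ 2 is an underlined block (entries must be adjacent),
-- a block of length 1 is an ordinary (non-underlined) entry.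
-- E.g. 3̲2̲1 = (3 ∷ 2 ∷ []) ∷ (1 ∷ []) ∷ [].

Pattern : Set
Pattern = List (List ℕ)

entries : Pattern → List ℕ
entries = concat

-- positions j (0-based, in the flattened pattern) such that entries j and
-- j+1 lie in a common underlined block
blockAdj : ℕ → List ℕ → List ℕ
blockAdj o []           = []
blockAdj o (x ∷ [])     = []
blockAdj o (x ∷ y ∷ r)  = o ∷ blockAdj (suc o) (y ∷ r)

adjPosFrom : ℕ → Pattern → List ℕ
adjPosFrom o []       = []
adjPosFrom o (b ∷ bs) = blockAdj o b ++ adjPosFrom (o + length b) bs

adjPos : Pattern → List ℕ
adjPos = adjPosFrom 0

Contains : List ℕ → Pattern → Set
Contains s σ =
  Σ (Fin (length (entries σ)) → Fin (length s)) λ idx →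
    (∀ j j' → toℕ j < toℕ j' → toℕ (idx j) < toℕ (idx j'))
  × (∀ j j' → (lookup (entries σ) j < lookup (entries σ) j'
                 → lookup s (idx j) < lookup s (idx j'))
            × (lookup s (idx j) < lookup s (idx j')
                 → lookup (entries σ) j < lookup (entries σ) j'))
  × (∀ j j' → toℕ j' ≡ suc (toℕ j) → toℕ j ∈ adjPos σ
            → toℕ (idx j') ≡ suc (toℕ (idx j)))

Avoids : List ℕ → Pattern → Set
Avoids s σ = ¬ Contains s σ

u123 : Pattern
u123 = (1 ∷ 2 ∷ 3 ∷ []) ∷ []

p132 : Pattern
p132 = (1 ∷ []) ∷ (3 ∷ []) ∷ (2 ∷ []) ∷ []

u321 : Pattern
u321 = (3 ∷ 2 ∷ []) ∷ (1 ∷ []) ∷ []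

-- Pattern-avoiding stack map s_σ.  Stacks are lists, top first.
-- It is parameterised by a decision procedure for containment of σ
-- (any such procedure gives the same map).

module StackMap (σ : Pattern) (dec : (s : List ℕ) → Dec (Contains s σ)) where

  pops : ℕ → List ℕ → List ℕ × List ℕ
  pops x []       = [] , []
  pops x (t ∷ st) with does (dec (x ∷ t ∷ st))
  ... | Data.Bool.true  with pops x st
  ...   | o , r = t ∷ o , r
  pops x (t ∷ st) | Data.Bool.false = [] , t ∷ st

  run : List ℕ → List ℕ → List ℕ → List ℕ
  run out stack []       = out ++ stack
  run out stack (x ∷ xs) with pops x stack
  ... | o , r = run (out ++ o) (x ∷ r) xs

  sσ : List ℕ → List ℕ
  sσ = run [] []

westPops : ℕ → List ℕ → List ℕ × List ℕ
westPops x []       = [] , []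
westPops x (t ∷ st) with does (t <? x)
... | Data.Bool.true with westPops x st
...   | o , r = t ∷ o , r
westPops x (t ∷ st) | Data.Bool.false = [] , t ∷ st

westRun : List ℕ → List ℕ → List ℕ → List ℕ
westRun out stack []       = out ++ stack
westRun out stack (x ∷ xs) with westPops x stack
... | o , r = westRun (out ++ o) (x ∷ r) xs

west : List ℕ → List ℕ
west = westRun [] []

InSort : (σ : Pattern) → ((s : List ℕ) → Dec (Contains s σ)) → ℕ → List ℕ → Set
InSort σ dec n τ = IsPerm n τ × west (StackMap.sσ σ dec τ) ≡ oneTo n

InAv : List Pattern → ℕ → List ℕ → Set
InAv ps n τ = IsPerm n τ × (∀ {σ} → σ ∈ ps → Avoids τ σ)

-- Pushing x onto a stack t ∷ s that avoids 3̲2̲1 creates a 3̲2̲1 exactly when t < x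
-- and some entry of s lies below t. The pops that follow remove t but never the
-- smallest entry of the stack (an entry is popped only when a smaller one lies
-- beneath it), so t, x and a small entry left under x form a 231 in the output.
-- As West's map sorts exactly the 231-avoiding words, τ is sortable iff the
-- 3̲2̲1-map never pops on τ and its output, the reverse of τ, avoids 231, i.e. τ
-- avoids 132. A 1̲2̲3̲ in τ forces a pop. Conversely, a pop needs a 3̲2̲1 a b … c in
-- a reversed prefix of τ; if d follows b there (d ≠ b, as τ is a permutation),
-- then a b d is a 3̲2̲1̲ when d < b and b d c is a 231 when d > b, giving a 1̲2̲3̲
-- or a 132 in τ.

module Submission where

open import Defs
open import Data.Bool using (true; false)
open import Data.Empty using (⊥-elim)
open import Data.Fin using (Fin; toℕ) renaming (zero to fz; suc to fs)
open import Data.List using (List; []; _∷_; _++_; _ʳ++_; reverse; length; lookup)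
open import Data.List.Properties using (++-assoc; ++-identityʳ; ʳ++-defn; ++-ʳ++; reverse-involutive)
open import Data.List.Membership.Propositional using (_∈_)
open import Data.List.Membership.Propositional.Properties using (∈-lookup; ∈-++⁺ʳ; ∈-++⁻)
open import Data.List.Relation.Binary.Permutation.Propositional
  using (_↭_; ↭-sym; ↭-trans; ↭-reflexive; ↭⇒↭ₛ; module PermutationReasoning)
open import Data.List.Relation.Binary.Permutation.Propositional.Properties
  using (shift; ∈-resp-↭; ↭-reverse) renaming (++⁺ˡ to ↭-++⁺ˡ)
open import Data.List.Relation.Binary.Permutation.Setoid.Properties using (Unique-resp-↭)
open import Data.List.Relation.Binary.Pointwise using (Pointwise-≡⇒≡)
open import Data.List.Relation.Binary.Sublist.Propositional
  using (_⊆_; []; _∷_; _∷ʳ_; from∈; to∈; ⊆-refl; ⊆-trans)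
open import Data.List.Relation.Binary.Sublist.Propositional.Properties
  using (∷ˡ⁻; ++⁺; ++⁺ˡ; All-resp-⊆; reverse⁺; reverse⁻)
open import Data.List.Relation.Unary.All as All using (All; []; _∷_)
import Data.List.Relation.Unary.All.Properties as All
open import Data.List.Relation.Unary.AllPairs as AllPairs using (AllPairs; []; _∷_)
import Data.List.Relation.Unary.AllPairs.Properties as AllPairs
open import Data.List.Relation.Unary.Any using (here; there; index)
open import Data.List.Relation.Unary.Any.Properties using (lookup-index)
open import Data.List.Relation.Unary.Linked.Properties using (AllPairs⇒Linked)
open import Data.List.Relation.Unary.Sorted.TotalOrder.Properties using (↗↭↗⇒≋)
open import Data.List.Relation.Unary.Unique.Propositional using (Unique)
open import Data.Nat using (ℕ; suc; _<_; _>_; _≤_; z<s; s<s; _<ᵇ_)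
open import Data.Nat.Properties
  using (<-cmp; <-trans; <-irrefl; <-asym; ≤-refl; ≤-trans; ≤-reflexive; ≤-<-trans; <-≤-trans;
         <⇒≤; <⇒≢; ≮⇒≥; suc-injective; ≤-totalOrder; <ᵇ-reflects-<)
open import Data.Product using (∃-syntax; _×_; _,_; proj₁; proj₂)
open import Data.Sum as Sum using (_⊎_; inj₁; inj₂; swap)
open import Data.Unit using (⊤; tt)
open import Function using (_∘_; flip; id)
open import Relation.Binary.Definitions using (tri<; tri≈; tri>)
open import Relation.Binary.PropositionalEquality
  using (_≡_; refl; sym; trans; cong; subst; subst₂; setoid; module ≡-Reasoning)
open import Relation.Nullary using (¬_; Dec; yes; no)
open import Relation.Nullary.Reflects using (ofʸ; ofⁿ)

-- List views of occurrences: Has321 is 3̲2̲1, Run3 _<_ is 1̲2̲3̲, Run3 _>_ is 3̲2̲1̲,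
-- and Has132, Has231 are occurrences of 132, 231 as subsequences.
data Has321 : List ℕ → Set where
  here  : ∀ {a b c s} → b < a → c ∈ s → c < b → Has321 (a ∷ b ∷ s)
  there : ∀ {x s} → Has321 s → Has321 (x ∷ s)

data Run3 (R : ℕ → ℕ → Set) (s : List ℕ) : Set where
  run3 : ∀ P {a b c} Q → s ≡ P ++ a ∷ b ∷ c ∷ Q → R a b → R b c → Run3 R s

data Has132 (s : List ℕ) : Set where
  has132 : ∀ {a b c} → a ∷ b ∷ c ∷ [] ⊆ s → a < c → c < b → Has132 s

data Has231 (s : List ℕ) : Set where
  has231 : ∀ {b c a} → b ∷ c ∷ a ∷ [] ⊆ s → a < b → b < c → Has231 s

Has231-resp-⊆ : ∀ {xs ys} → xs ⊆ ys → Has231 xs → Has231 ys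
Has231-resp-⊆ xs⊆ys (has231 p a<b b<c) = has231 (⊆-trans p xs⊆ys) a<b b<c

Has321-top : ∀ {x t s} → Has321 (x ∷ t ∷ s) → ¬ Has321 (t ∷ s) → t < x × ∃[ c ] c ∈ s × c < t
Has321-top (here t<x c∈s c<t) _     = t<x , _ , c∈s , c<t
Has321-top (there h)          clean = ⊥-elim (clean h)

++-Has321 : ∀ P {s} → Has321 s → Has321 (P ++ s)
++-Has321 []      h = h
++-Has321 (x ∷ P) h = there (++-Has321 P h)

no321-singleton : ∀ {x} → ¬ Has321 (x ∷ [])
no321-singleton (there ())

Has321⇒Run3⊎Has231 : ∀ {s} → Unique s → Has321 s → Run3 _>_ s ⊎ Has231 s
Has321⇒Run3⊎Has231 (_ ∷ unique) (there {x} h) =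
  Sum.map (λ { (run3 P Q refl ab bc) → run3 (x ∷ P) Q refl ab bc }) (Has231-resp-⊆ (x ∷ʳ ⊆-refl))
    (Has321⇒Run3⊎Has231 unique h)
Has321⇒Run3⊎Has231 _ (here {s = _ ∷ s} b<a (here refl) c<b) = inj₁ (run3 [] s refl b<a c<b)
Has321⇒Run3⊎Has231 (_ ∷ (b≢d ∷ _) ∷ _) (here {a} {b} b<a (there {d} {s} c∈s) c<b) with <-cmp d b
... | tri< d<b _ _ = inj₁ (run3 [] s refl b<a d<b)
... | tri≈ _ d≡b _ = ⊥-elim (b≢d (sym d≡b))
... | tri> _ _ b<d = inj₂ (has231 (a ∷ʳ refl ∷ refl ∷ from∈ c∈s) c<b b<d)

Run3-reverse : ∀ {R s} → Run3 R s → Run3 (flip R) (reverse s)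
Run3-reverse (run3 P Q refl ab bc) =
  run3 (reverse Q) (reverse P) (trans (++-ʳ++ P) (ʳ++-defn Q)) bc ab

Has132⇒Has231-reverse : ∀ {s} → Has132 s → Has231 (reverse s)
Has132⇒Has231-reverse (has132 p a<c c<b) = has231 (reverse⁺ p) a<c c<b

Has231-reverse⇒Has132 : ∀ {s} → Has231 (reverse s) → Has132 s
Has231-reverse⇒Has132 (has231 {b} {c} {a} p a<b b<c) =
  has132 (reverse⁻ {as = a ∷ c ∷ b ∷ []} p) a<b b<c

triple : ∀ {A : Set} → A → A → A → Fin 3 → A
triple x y z fz           = x
triple x y z (fs fz)      = y
triple x y z (fs (fs fz)) = z

OrderIso : (Fin 3 → ℕ) → (Fin 3 → ℕ) → Set
OrderIso e v = ∀ a b → (e a < e b → v a < v b) × (v a < v b → e a < e b)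

Agree : (Fin 3 → ℕ) → (Fin 3 → ℕ) → Fin 3 → Fin 3 → Set
Agree e v a b = (e a < e b × v a < v b) ⊎ (e b < e a × v b < v a)

orderIso3 : ∀ e v → Agree e v fz (fs fz) → Agree e v fz (fs (fs fz)) → Agree e v (fs fz) (fs (fs fz)) →
            OrderIso e v
orderIso3 e v a₀₁ a₀₂ a₁₂ = λ where
    fz           fz           → irreflexive
    fz           (fs fz)      → agreeing a₀₁
    fz           (fs (fs fz)) → agreeing a₀₂
    (fs fz)      fz           → agreeing (swap a₀₁)
    (fs fz)      (fs fz)      → irreflexive
    (fs fz)      (fs (fs fz)) → agreeing a₁₂
    (fs (fs fz)) fz           → agreeing (swap a₀₂)
    (fs (fs fz)) (fs fz)      → agreeing (swap a₁₂)
    (fs (fs fz)) (fs (fs fz)) → irreflexive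
  where
  irreflexive : ∀ {m n} → (m < m → n < n) × (n < n → m < m)
  irreflexive = (λ m<m → ⊥-elim (<-irrefl refl m<m)) , (λ n<n → ⊥-elim (<-irrefl refl n<n))
  agreeing : ∀ {a b} → Agree e v a b → (e a < e b → v a < v b) × (v a < v b → e a < e b)
  agreeing (inj₁ (e< , v<)) = (λ _ → v<) , (λ _ → e<)
  agreeing (inj₂ (e> , v>)) = (λ e< → ⊥-elim (<-asym e< e>)) , (λ v< → ⊥-elim (<-asym v< v>))

triple-increasing : ∀ {n} {i j k : Fin n} → toℕ i < toℕ j → toℕ j < toℕ k →
                    ∀ a b → toℕ a < toℕ b → toℕ (triple i j k a) < toℕ (triple i j k b)
triple-increasing i<j j<k fz           (fs fz)      _ = i<j
triple-increasing i<j j<k fz           (fs (fs fz)) _ = <-trans i<j j<k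
triple-increasing i<j j<k (fs fz)      (fs (fs fz)) _ = j<k
triple-increasing i<j j<k fz           fz           ()
triple-increasing i<j j<k (fs fz)      fz           ()
triple-increasing i<j j<k (fs fz)      (fs fz)      (s<s ())
triple-increasing i<j j<k (fs (fs fz)) fz           ()
triple-increasing i<j j<k (fs (fs fz)) (fs fz)      (s<s ())
triple-increasing i<j j<k (fs (fs fz)) (fs (fs fz)) (s<s (s<s ()))

triple-adjacent : ∀ (Adj : ℕ → Set) {n} {i j k : Fin n} →
                  (Adj 0 → toℕ j ≡ suc (toℕ i)) → (Adj 1 → toℕ k ≡ suc (toℕ j)) →
                  ∀ a b → toℕ b ≡ suc (toℕ a) → Adj (toℕ a) →
                  toℕ (triple i j k b) ≡ suc (toℕ (triple i j k a))
triple-adjacent Adj adj₀ adj₁ fz           (fs fz)      _ = adj₀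
triple-adjacent Adj adj₀ adj₁ (fs fz)      (fs (fs fz)) _ = adj₁
triple-adjacent Adj adj₀ adj₁ fz           fz           ()
triple-adjacent Adj adj₀ adj₁ fz           (fs (fs fz)) ()
triple-adjacent Adj adj₀ adj₁ (fs fz)      fz           ()
triple-adjacent Adj adj₀ adj₁ (fs fz)      (fs fz)      ()
triple-adjacent Adj adj₀ adj₁ (fs (fs fz)) fz           ()
triple-adjacent Adj adj₀ adj₁ (fs (fs fz)) (fs fz)      ()
triple-adjacent Adj adj₀ adj₁ (fs (fs fz)) (fs (fs fz)) ()

Contains-u321-at : ∀ s (i j k : Fin (length s)) → toℕ j ≡ suc (toℕ i) → toℕ j < toℕ k →
                   lookup s j < lookup s i → lookup s k < lookup s j → Contains s u321
Contains-u321-at s i j k j≡i+1 j<k b<a c<b =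
  triple i j k ,
  triple-increasing (≤-reflexive (sym j≡i+1)) j<k ,
  orderIso3 _ _ (inj₂ (s<s (s<s z<s) , b<a)) (inj₂ (s<s z<s , <-trans c<b b<a)) (inj₂ (s<s z<s , c<b)) ,
  triple-adjacent (_∈ adjPos u321) (λ _ → j≡i+1) λ { (here ()) ; (there ()) }

Contains-u123-at : ∀ s (i j k : Fin (length s)) → toℕ j ≡ suc (toℕ i) → toℕ k ≡ suc (toℕ j) →
                   lookup s i < lookup s j → lookup s j < lookup s k → Contains s u123
Contains-u123-at s i j k j≡i+1 k≡j+1 a<b b<c =
  triple i j k ,
  triple-increasing (≤-reflexive (sym j≡i+1)) (≤-reflexive (sym k≡j+1)) ,
  orderIso3 _ _ (inj₁ (s<s z<s , a<b)) (inj₁ (s<s z<s , <-trans a<b b<c)) (inj₁ (s<s (s<s z<s) , b<c)) ,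
  triple-adjacent (_∈ adjPos u123) (λ _ → j≡i+1) (λ _ → k≡j+1)

Contains-p132-at : ∀ s (i j k : Fin (length s)) → toℕ i < toℕ j → toℕ j < toℕ k →
                   lookup s i < lookup s k → lookup s k < lookup s j → Contains s p132
Contains-p132-at s i j k i<j j<k a<c c<b =
  triple i j k ,
  triple-increasing i<j j<k ,
  orderIso3 _ _ (inj₁ (s<s z<s , <-trans a<c c<b)) (inj₁ (s<s z<s , a<c)) (inj₂ (s<s (s<s z<s) , c<b)) ,
  triple-adjacent (_∈ adjPos p132) (λ ()) (λ ())

Has321-at : ∀ s (i j k : Fin (length s)) → toℕ j ≡ suc (toℕ i) → toℕ j < toℕ k →
            lookup s j < lookup s i → lookup s k < lookup s j → Has321 s
Has321-at (a ∷ b ∷ s) fz     (fs fz) (fs (fs k)) _     _         b<a c<b = here b<a (∈-lookup k) c<b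
Has321-at (x ∷ s)     (fs i) (fs j)  (fs k)      j≡i+1 (s<s j<k) b<a c<b =
  there (Has321-at s i j k (suc-injective j≡i+1) j<k b<a c<b)
Has321-at (x ∷ s)     fz     fz          k       () _        _ _
Has321-at (a ∷ b ∷ s) fz     (fs fz)     fz      _  ()       _ _
Has321-at (a ∷ b ∷ s) fz     (fs fz)     (fs fz) _  (s<s ()) _ _
Has321-at (a ∷ b ∷ s) fz     (fs (fs j)) k       () _        _ _
Has321-at (x ∷ s)     (fs i) fz          k       () _        _ _
Has321-at (x ∷ s)     (fs i) (fs j)      fz      _  ()       _ _

Run3-at : ∀ {R} s (i j k : Fin (length s)) → toℕ j ≡ suc (toℕ i) → toℕ k ≡ suc (toℕ j) →
          R (lookup s i) (lookup s j) → R (lookup s j) (lookup s k) → Run3 R s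
Run3-at (a ∷ b ∷ c ∷ s) fz     (fs fz) (fs (fs fz)) _     _     ab bc = run3 [] s refl ab bc
Run3-at (x ∷ s)         (fs i) (fs j)  (fs k)       j≡i+1 k≡j+1 ab bc
  with run3 P Q s≡ ab bc ← Run3-at s i j k (suc-injective j≡i+1) (suc-injective k≡j+1) ab bc
  = run3 (x ∷ P) Q (cong (x ∷_) s≡) ab bc
Run3-at (x ∷ s)         fz     fz          k                () _  _ _
Run3-at (a ∷ b ∷ s)     fz     (fs (fs j)) k                () _  _ _
Run3-at (a ∷ b ∷ s)     fz     (fs fz)     fz               _  () _ _
Run3-at (a ∷ b ∷ s)     fz     (fs fz)     (fs fz)          _  () _ _
Run3-at (a ∷ b ∷ c ∷ s) fz     (fs fz)     (fs (fs (fs k))) _  () _ _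
Run3-at (x ∷ s)         (fs i) fz          k                () _  _ _
Run3-at (x ∷ s)         (fs i) (fs j)      fz               _  () _ _

lookup-pair⊆ : ∀ (s : List ℕ) (j k : Fin (length s)) → toℕ j < toℕ k →
               lookup s j ∷ lookup s k ∷ [] ⊆ s
lookup-pair⊆ (x ∷ s) fz     (fs k) _         = refl ∷ from∈ (∈-lookup k)
lookup-pair⊆ (x ∷ s) (fs j) (fs k) (s<s j<k) = x ∷ʳ lookup-pair⊆ s j k j<k
lookup-pair⊆ (x ∷ s) j      fz     ()

lookup-triple⊆ : ∀ (s : List ℕ) (i j k : Fin (length s)) → toℕ i < toℕ j → toℕ j < toℕ k →
                 lookup s i ∷ lookup s j ∷ lookup s k ∷ [] ⊆ s
lookup-triple⊆ (x ∷ s) fz     (fs j) (fs k) _         (s<s j<k) = refl ∷ lookup-pair⊆ s j k j<k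
lookup-triple⊆ (x ∷ s) (fs i) (fs j) (fs k) (s<s i<j) (s<s j<k) = x ∷ʳ lookup-triple⊆ s i j k i<j j<k
lookup-triple⊆ (x ∷ s) i      fz     k      ()        _
lookup-triple⊆ (x ∷ s) i      (fs j) fz     _         ()

⊆-index : ∀ {xs ys : List ℕ} → xs ⊆ ys → Fin (length xs) → Fin (length ys)
⊆-index (y ∷ʳ p)   i      = fs (⊆-index p i)
⊆-index (refl ∷ p) fz     = fz
⊆-index (refl ∷ p) (fs i) = fs (⊆-index p i)

⊆-index-increasing : ∀ {xs ys : List ℕ} (p : xs ⊆ ys) i j → toℕ i < toℕ j →
                     toℕ (⊆-index p i) < toℕ (⊆-index p j)
⊆-index-increasing (y ∷ʳ p)   i      j      i<j       = s<s (⊆-index-increasing p i j i<j)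
⊆-index-increasing (refl ∷ p) fz     (fs j) _         = z<s
⊆-index-increasing (refl ∷ p) (fs i) (fs j) (s<s i<j) = s<s (⊆-index-increasing p i j i<j)

lookup-⊆-index : ∀ {xs ys : List ℕ} (p : xs ⊆ ys) i → lookup ys (⊆-index p i) ≡ lookup xs i
lookup-⊆-index (y ∷ʳ p)   i      = lookup-⊆-index p i
lookup-⊆-index (refl ∷ p) fz     = refl
lookup-⊆-index (refl ∷ p) (fs i) = lookup-⊆-index p i

∷-contains : ∀ σ {s} x → Contains s σ → Contains (x ∷ s) σ
∷-contains σ x (idx , increasing , iso , adjacent) =
  (λ a → fs (idx a)) , (λ a b a<b → s<s (increasing a b a<b)) , iso ,
  (λ a b b≡a+1 adj → cong suc (adjacent a b b≡a+1 adj))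

++-contains : ∀ σ {s} P → Contains s σ → Contains (P ++ s) σ
++-contains σ []      c = c
++-contains σ (x ∷ P) c = ∷-contains σ x (++-contains σ P c)

Has321⇒Contains : ∀ {s} → Has321 s → Contains s u321
Has321⇒Contains (there {x} h) = ∷-contains u321 x (Has321⇒Contains h)
Has321⇒Contains (here {a} {b} {c} {s} b<a c∈s c<b) =
  Contains-u321-at (a ∷ b ∷ s) fz (fs fz) (fs (fs (index c∈s))) refl (s<s z<s) b<a
    (subst (_< b) (lookup-index c∈s) c<b)

Contains⇒Has321 : ∀ {s} → Contains s u321 → Has321 s
Contains⇒Has321 {s} (idx , increasing , iso , adjacent) =
  Has321-at s (idx fz) (idx (fs fz)) (idx (fs (fs fz)))
    (adjacent fz (fs fz) refl (here refl)) (increasing (fs fz) (fs (fs fz)) (s<s z<s))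
    (proj₁ (iso (fs fz) fz) (s<s (s<s z<s))) (proj₁ (iso (fs (fs fz)) (fs fz)) (s<s z<s))

Run3⇒Contains : ∀ {s} → Run3 _<_ s → Contains s u123
Run3⇒Contains (run3 P {a} {b} {c} Q refl a<b b<c) =
  ++-contains u123 P (Contains-u123-at (a ∷ b ∷ c ∷ Q) fz (fs fz) (fs (fs fz)) refl refl a<b b<c)

Contains⇒Run3 : ∀ {s} → Contains s u123 → Run3 _<_ s
Contains⇒Run3 {s} (idx , increasing , iso , adjacent) =
  Run3-at s (idx fz) (idx (fs fz)) (idx (fs (fs fz)))
    (adjacent fz (fs fz) refl (here refl)) (adjacent (fs fz) (fs (fs fz)) refl (there (here refl)))
    (proj₁ (iso fz (fs fz)) (s<s z<s)) (proj₁ (iso (fs fz) (fs (fs fz))) (s<s (s<s z<s)))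

Has132⇒Contains : ∀ {s} → Has132 s → Contains s p132
Has132⇒Contains {s} (has132 p a<c c<b) =
  Contains-p132-at s (at fz) (at (fs fz)) (at (fs (fs fz)))
    (⊆-index-increasing p fz (fs fz) z<s) (⊆-index-increasing p (fs fz) (fs (fs fz)) (s<s z<s))
    (subst₂ _<_ (sym (lookup-⊆-index p fz)) (sym (lookup-⊆-index p (fs (fs fz)))) a<c)
    (subst₂ _<_ (sym (lookup-⊆-index p (fs (fs fz)))) (sym (lookup-⊆-index p (fs fz))) c<b)
  where at = ⊆-index p

Contains⇒Has132 : ∀ {s} → Contains s p132 → Has132 s
Contains⇒Has132 {s} (idx , increasing , iso , _) =
  has132 (lookup-triple⊆ s (idx fz) (idx (fs fz)) (idx (fs (fs fz)))
            (increasing fz (fs fz) z<s) (increasing (fs fz) (fs (fs fz)) (s<s z<s)))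
    (proj₁ (iso fz (fs (fs fz))) (s<s z<s)) (proj₁ (iso (fs (fs fz)) (fs fz)) (s<s (s<s z<s)))

AllPairs-resp-⊆ : ∀ {R : ℕ → ℕ → Set} {xs ys} → xs ⊆ ys → AllPairs R ys → AllPairs R xs
AllPairs-resp-⊆ []         []       = []
AllPairs-resp-⊆ (y ∷ʳ p)   (_ ∷ rs) = AllPairs-resp-⊆ p rs
AllPairs-resp-⊆ (refl ∷ p) (r ∷ rs) = All-resp-⊆ p r ∷ AllPairs-resp-⊆ p rs

AllPairs-++⁻ʳ : ∀ {R : ℕ → ℕ → Set} xs {ys} → AllPairs R (xs ++ ys) → AllPairs R ys
AllPairs-++⁻ʳ []       rs       = rs
AllPairs-++⁻ʳ (x ∷ xs) (_ ∷ rs) = AllPairs-++⁻ʳ xs rs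

AllPairs-insert : ∀ {R : ℕ → ℕ → Set} xs {ys z} → AllPairs R (xs ++ ys) →
                  All (λ x → R x z) xs → All (R z) ys → AllPairs R (xs ++ z ∷ ys)
AllPairs-insert []       rs        []           z≤ys = z≤ys ∷ rs
AllPairs-insert (x ∷ xs) (x≤ ∷ rs) (x≤z ∷ xs≤z) z≤ys =
  All.++⁺ (All.++⁻ˡ xs x≤) (x≤z ∷ All.++⁻ʳ xs x≤) ∷ AllPairs-insert xs rs xs≤z z≤ys

oneTo-increasing : ∀ n → AllPairs _<_ (oneTo n)
oneTo-increasing n = AllPairs.map⁺ (AllPairs.applyUpTo⁺₁ id n (λ i<j _ → s<s i<j))

oneTo-sorted : ∀ n → AllPairs _≤_ (oneTo n)
oneTo-sorted n = AllPairs.map <⇒≤ (oneTo-increasing n)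

unique-↭-oneTo : ∀ {n s} → s ↭ oneTo n → Unique s
unique-↭-oneTo {n} s↭ =
  Unique-resp-↭ (setoid ℕ) (↭⇒↭ₛ (↭-sym s↭)) (AllPairs.map <⇒≢ (oneTo-increasing n))

sorted-↭-oneTo : ∀ {n s} → AllPairs _≤_ s → s ↭ oneTo n → s ≡ oneTo n
sorted-↭-oneTo {n} s↗ s↭ = Pointwise-≡⇒≡
  (↗↭↗⇒≋ ≤-totalOrder (AllPairs⇒Linked s↗) (AllPairs⇒Linked (oneTo-sorted n)) (↭⇒↭ₛ s↭))

Pop : Set
Pop = ℕ → List ℕ → List ℕ × List ℕ

runWith : Pop → List ℕ → List ℕ → List ℕ → List ℕ
runWith pop out st []       = out ++ st
runWith pop out st (x ∷ xs) = runWith pop (out ++ proj₁ (pop x st)) (x ∷ proj₂ (pop x st)) xs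

PopsPrefix : Pop → Set
PopsPrefix pop = ∀ x st → proj₁ (pop x st) ++ proj₂ (pop x st) ≡ st

runWith-decomposes : ∀ {pop} → PopsPrefix pop → ∀ out st xs →
                     ∃[ R ] runWith pop out st xs ≡ out ++ R × st ⊆ R × R ↭ st ++ xs
runWith-decomposes prefix out st [] = st , refl , ⊆-refl , ↭-reflexive (sym (++-identityʳ st))
runWith-decomposes {pop} prefix out st (x ∷ xs)
  with R , run≡ , x∷kept⊆R , R↭ ←
         runWith-decomposes prefix (out ++ proj₁ (pop x st)) (x ∷ proj₂ (pop x st)) xs
  = popped ++ R , trans run≡ (++-assoc out popped R) ,
    subst (_⊆ popped ++ R) (prefix x st) (++⁺ ⊆-refl (∷ˡ⁻ x∷kept⊆R)) , popped++R↭
  where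
  popped = proj₁ (pop x st)
  kept   = proj₂ (pop x st)
  open PermutationReasoning
  popped++R↭ : popped ++ R ↭ st ++ x ∷ xs
  popped++R↭ = begin
    popped ++ R                ↭⟨ ↭-++⁺ˡ popped R↭ ⟩
    popped ++ x ∷ kept ++ xs   ↭⟨ ↭-++⁺ˡ popped (↭-sym (shift x kept xs)) ⟩
    popped ++ kept ++ x ∷ xs   ≡⟨ sym (++-assoc popped kept (x ∷ xs)) ⟩
    (popped ++ kept) ++ x ∷ xs ≡⟨ cong (_++ x ∷ xs) (prefix x st) ⟩
    st ++ x ∷ xs               ∎

runWith-output-first : ∀ {pop} → PopsPrefix pop → ∀ {b a} out st xs → b ∈ out → a ∈ st ++ xs →
                       b ∷ a ∷ [] ⊆ runWith pop out st xs
runWith-output-first prefix out st xs b∈out a∈rest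
  with R , run≡ , _ , R↭ ← runWith-decomposes prefix out st xs
  = subst (_ ∷ _ ∷ [] ⊆_) (sym run≡) (++⁺ (from∈ b∈out) (from∈ (∈-resp-↭ (↭-sym R↭) a∈rest)))

∈-popped⊎kept : ∀ pop → PopsPrefix pop → ∀ {b} x st → b ∈ st →
                b ∈ proj₁ (pop x st) ⊎ b ∈ proj₂ (pop x st)
∈-popped⊎kept pop prefix x st b∈st =
  ∈-++⁻ (proj₁ (pop x st)) (subst (_ ∈_) (sym (prefix x st)) b∈st)

westRun≡runWith : ∀ out st xs → westRun out st xs ≡ runWith westPops out st xs
westRun≡runWith out st []       = refl
westRun≡runWith out st (x ∷ xs) = westRun≡runWith _ _ xs

westPops-prefix : PopsPrefix westPops
westPops-prefix x []       = refl
westPops-prefix x (t ∷ st) with t <ᵇ x | <ᵇ-reflects-< t x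
... | true  | _ = cong (t ∷_) (westPops-prefix x st)
... | false | _ = refl

westPops-popped : ∀ x st → All (_< x) (proj₁ (westPops x st))
westPops-popped x []       = []
westPops-popped x (t ∷ st) with t <ᵇ x | <ᵇ-reflects-< t x
... | true  | ofʸ t<x = t<x ∷ westPops-popped x st
... | false | _       = []

westPops-kept : ∀ x st → AllPairs _≤_ st → All (x ≤_) (proj₂ (westPops x st))
westPops-kept x []       _             = []
westPops-kept x (t ∷ st) (t≤st ∷ st↗) with t <ᵇ x | <ᵇ-reflects-< t x
... | true  | _       = westPops-kept x st st↗
... | false | ofⁿ t≮x = ≮⇒≥ t≮x ∷ All.map (≤-trans (≮⇒≥ t≮x)) t≤st

westPush-sorted : ∀ x st → AllPairs _≤_ st → AllPairs _≤_ (x ∷ proj₂ (westPops x st))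
westPush-sorted x st st↗ = westPops-kept x st st↗ ∷
  AllPairs-++⁻ʳ (proj₁ (westPops x st)) (subst (AllPairs _≤_) (sym (westPops-prefix x st)) st↗)

popped-below-rest : ∀ {u x xs} → ¬ Has231 (u ∷ x ∷ xs) → u < x → All (u ≤_) xs
popped-below-rest no231 u<x = All.tabulate λ y∈xs →
  ≮⇒≥ λ y<u → no231 (has231 (refl ∷ refl ∷ from∈ y∈xs) y<u u<x)

west-sorted-from : ∀ out st xs → AllPairs _≤_ (out ++ st) → All (λ u → All (u ≤_) xs) out →
                   All (λ t → ¬ Has231 (t ∷ xs)) st → ¬ Has231 xs →
                   AllPairs _≤_ (runWith westPops out st xs)
west-sorted-from out st []       sorted _     _        _     = sorted
west-sorted-from out st (x ∷ xs) sorted out≤xs st-no231 no231 =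
  west-sorted-from (out ++ popped) (x ∷ kept) xs sorted′ out≤xs′ st-no231′
    (no231 ∘ Has231-resp-⊆ (x ∷ʳ ⊆-refl))
  where
  popped = proj₁ (westPops x st)
  kept   = proj₂ (westPops x st)
  st≡ : st ≡ popped ++ kept
  st≡ = sym (westPops-prefix x st)
  popped<x : All (_< x) popped
  popped<x = westPops-popped x st
  popped-no231 : All (λ t → ¬ Has231 (t ∷ x ∷ xs)) popped
  popped-no231 = All.++⁻ˡ popped (subst (All _) st≡ st-no231)
  sorted′ : AllPairs _≤_ ((out ++ popped) ++ x ∷ kept)
  sorted′ = AllPairs-insert (out ++ popped)
    (subst (AllPairs _≤_) (trans (cong (out ++_) st≡) (sym (++-assoc out popped kept))) sorted)
    (All.++⁺ (All.map All.head out≤xs) (All.map <⇒≤ popped<x))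
    (westPops-kept x st (AllPairs-++⁻ʳ out sorted))
  out≤xs′ : All (λ u → All (u ≤_) xs) (out ++ popped)
  out≤xs′ = All.++⁺ (All.map All.tail out≤xs)
    (All.zipWith (λ (no231 , u<x) → popped-below-rest no231 u<x) (popped-no231 , popped<x))
  st-no231′ : All (λ t → ¬ Has231 (t ∷ xs)) (x ∷ kept)
  st-no231′ = no231 ∷
    All.map (_∘ Has231-resp-⊆ (refl ∷ x ∷ʳ ⊆-refl)) (All.++⁻ʳ popped (subst (All _) st≡ st-no231))

west-sorted : ∀ w → ¬ Has231 w → AllPairs _≤_ (west w)
west-sorted w no231 =
  subst (AllPairs _≤_) (sym (westRun≡runWith [] [] w)) (west-sorted-from [] [] w [] [] [] no231)

west-inverts-stacked : ∀ {b c a} out st xs → AllPairs _≤_ st → b ∈ st → b < c → c ∷ a ∷ [] ⊆ xs →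
                       b ∷ a ∷ [] ⊆ runWith westPops out st xs
west-inverts-stacked out st (x ∷ xs) st↗ b∈st b<c (_ ∷ʳ ca⊆xs)
  with ∈-popped⊎kept westPops westPops-prefix x st b∈st
... | inj₁ b∈popped = runWith-output-first westPops-prefix _ _ xs
                        (∈-++⁺ʳ out b∈popped) (∈-++⁺ʳ (x ∷ _) (to∈ (∷ˡ⁻ ca⊆xs)))
... | inj₂ b∈kept   = west-inverts-stacked _ _ xs (westPush-sorted x st st↗) (there b∈kept) b<c ca⊆xs
west-inverts-stacked out st (x ∷ xs) st↗ b∈st b<c (refl ∷ a⊆xs)
  with ∈-popped⊎kept westPops westPops-prefix x st b∈st
... | inj₁ b∈popped = runWith-output-first westPops-prefix _ _ xs
                        (∈-++⁺ʳ out b∈popped) (∈-++⁺ʳ (x ∷ _) (to∈ a⊆xs))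
... | inj₂ b∈kept   = ⊥-elim (<-irrefl refl (<-≤-trans b<c (All.lookup (westPops-kept x st st↗) b∈kept)))

west-inverts-from : ∀ {b c a} out st xs → AllPairs _≤_ st → b ∷ c ∷ a ∷ [] ⊆ xs → b < c →
                    b ∷ a ∷ [] ⊆ runWith westPops out st xs
west-inverts-from out st (x ∷ xs) st↗ (_ ∷ʳ bca⊆xs) b<c =
  west-inverts-from _ _ xs (westPush-sorted x st st↗) bca⊆xs b<c
west-inverts-from out st (x ∷ xs) st↗ (refl ∷ ca⊆xs) b<c =
  west-inverts-stacked _ _ xs (westPush-sorted x st st↗) (here refl) b<c ca⊆xs

west-unsorted : ∀ w → Has231 w → ¬ AllPairs _≤_ (west w)
west-unsorted w (has231 bca⊆w a<b b<c) sorted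
  with AllPairs-resp-⊆ (west-inverts-from [] [] w [] bca⊆w b<c)
                       (subst (AllPairs _≤_) (westRun≡runWith [] [] w) sorted)
... | (b≤a ∷ []) ∷ _ = <-irrefl refl (<-≤-trans a<b b≤a)

west-↭ : ∀ w → west w ↭ w
west-↭ w with R , run≡ , _ , R↭ ← runWith-decomposes westPops-prefix [] [] w
  = subst (_↭ w) (sym (trans (westRun≡runWith [] [] w) run≡)) R↭

-- The 3̲2̲1-map pops only when pushing creates a 3̲2̲1, so NoPop st xs says that
-- reading xs onto the stack st never pops.
NoPop : List ℕ → List ℕ → Set
NoPop st []       = ⊤
NoPop st (x ∷ xs) = ¬ Has321 (x ∷ st) × NoPop (x ∷ st) xs

module Stack321 (dec : (s : List ℕ) → Dec (Contains s u321)) where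
  open StackMap u321 dec

  run≡runWith : ∀ out st xs → run out st xs ≡ runWith pops out st xs
  run≡runWith out st []       = refl
  run≡runWith out st (x ∷ xs) = run≡runWith _ _ xs

  pops-prefix : PopsPrefix pops
  pops-prefix x []       = refl
  pops-prefix x (t ∷ st) with dec (x ∷ t ∷ st)
  ... | yes _ = cong (t ∷_) (pops-prefix x st)
  ... | no  _ = refl

  -- An entry is popped only when a smaller entry lies beneath it.
  pops-keeps-below : ∀ x st {c} → ¬ Has321 st → c ∈ st → ∃[ μ ] μ ∈ proj₂ (pops x st) × μ ≤ c
  pops-keeps-below x (u ∷ s) {c} clean c∈st with dec (x ∷ u ∷ s) | c∈st
  ... | no _  | _         = c , c∈st , ≤-refl
  ... | yes _ | there c∈s = pops-keeps-below x s (clean ∘ there) c∈s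
  ... | yes C | here refl
    with _ , c′ , c′∈s , c′<c ← Has321-top (Contains⇒Has321 C) clean
    with μ , μ∈kept , μ≤c′ ← pops-keeps-below x s (clean ∘ there) c′∈s
    = μ , μ∈kept , <⇒≤ (≤-<-trans μ≤c′ c′<c)

  run-without-pops : ∀ st xs → NoPop st xs → runWith pops [] st xs ≡ xs ʳ++ st
  run-without-pops st       []       _              = refl
  run-without-pops []       (x ∷ xs) (_ , rest)     = run-without-pops (x ∷ []) xs rest
  run-without-pops (t ∷ st) (x ∷ xs) (clean , rest) with dec (x ∷ t ∷ st)
  ... | yes C = ⊥-elim (clean (Contains⇒Has321 C))
  ... | no  _ = run-without-pops (x ∷ t ∷ st) xs rest

  noPop-or-231 : ∀ st xs → ¬ Has321 st → NoPop st xs ⊎ Has231 (runWith pops [] st xs)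
  noPop-or-231 st      []       _ = inj₁ tt
  noPop-or-231 []      (x ∷ xs) _ =
    Sum.map₁ (no321-singleton ,_) (noPop-or-231 (x ∷ []) xs no321-singleton)
  noPop-or-231 (t ∷ s) (x ∷ xs) clean with dec (x ∷ t ∷ s)
  ... | no ¬C = Sum.map₁ (clean′ ,_) (noPop-or-231 (x ∷ t ∷ s) xs clean′)
    where clean′ = ¬C ∘ Has321⇒Contains
  ... | yes C
    with t<x , c , c∈s , c<t ← Has321-top (Contains⇒Has321 C) clean
    with μ , μ∈kept , μ≤c ← pops-keeps-below x s (clean ∘ there) c∈s
    with R , run≡ , x∷kept⊆R , _ ←
           runWith-decomposes pops-prefix (t ∷ proj₁ (pops x s)) (x ∷ proj₂ (pops x s)) xs
    = inj₂ (has231 (subst (_ ∷ _ ∷ _ ∷ [] ⊆_) (sym run≡)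
                      (refl ∷ ++⁺ˡ _ (⊆-trans (refl ∷ from∈ μ∈kept) x∷kept⊆R)))
                   (≤-<-trans μ≤c c<t) t<x)

  -- Every stack x ∷ st met on the way is a suffix of the fixed list xs ʳ++ st.
  noPop-from-reverse : ∀ st xs → Unique (xs ʳ++ st) → ¬ Run3 _>_ (xs ʳ++ st) → ¬ Has231 (xs ʳ++ st) →
                       NoPop st xs
  noPop-from-reverse st []       _      _     _     = tt
  noPop-from-reverse st (x ∷ xs) unique no321 no231 =
    clean , noPop-from-reverse (x ∷ st) xs unique no321 no231
    where
    clean : ¬ Has321 (x ∷ st)
    clean h = Sum.[ no321 , no231 ]
      (Has321⇒Run3⊎Has231 unique (subst Has321 (sym (ʳ++-defn xs)) (++-Has321 (reverse xs) h)))

  NoPop⇒¬Run3 : ∀ {st xs} → NoPop st xs → ¬ Run3 _<_ xs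
  NoPop⇒¬Run3 noPop (run3 P {a} {b} {c} Q refl a<b b<c) = go P noPop
    where
    go : ∀ {st} P → ¬ NoPop st (P ++ a ∷ b ∷ c ∷ Q)
    go []      (_ , _ , clean , _) = clean (here b<c (here refl) a<b)
    go (x ∷ P) (_ , rest)          = go P rest

  sσ-reverses : ∀ τ → NoPop [] τ → sσ τ ≡ reverse τ
  sσ-reverses τ noPop = trans (run≡runWith [] [] τ) (run-without-pops [] τ noPop)

  sortable⇒avoiding : ∀ n τ → InSort u321 dec n τ → InAv (u123 ∷ p132 ∷ []) n τ
  sortable⇒avoiding n τ (τ-perm , sorts) = τ-perm , avoids
    where
    output-no231 : ¬ Has231 (sσ τ)
    output-no231 h = west-unsorted (sσ τ) h (subst (AllPairs _≤_) (sym sorts) (oneTo-sorted n))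
    τ-noPop : NoPop [] τ
    τ-noPop = Sum.[ id , ⊥-elim ∘ output-no231 ∘ subst Has231 (sym (run≡runWith [] [] τ)) ]
                (noPop-or-231 [] τ λ ())
    avoids : ∀ {σ} → σ ∈ u123 ∷ p132 ∷ [] → Avoids τ σ
    avoids (here refl)         C = NoPop⇒¬Run3 τ-noPop (Contains⇒Run3 {τ} C)
    avoids (there (here refl)) C = output-no231
      (subst Has231 (sym (sσ-reverses τ τ-noPop)) (Has132⇒Has231-reverse (Contains⇒Has132 {τ} C)))

  avoiding⇒sortable : ∀ n τ → InAv (u123 ∷ p132 ∷ []) n τ → InSort u321 dec n τ
  avoiding⇒sortable n τ (τ-perm , avoids) = τ-perm , sorts
    where
    no123 : ¬ Run3 _<_ τ
    no123 = avoids (here refl) ∘ Run3⇒Contains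
    no231 : ¬ Has231 (reverse τ)
    no231 h = avoids (there (here refl)) (Has132⇒Contains (Has231-reverse⇒Has132 {τ} h))
    τ-noPop : NoPop [] τ
    τ-noPop = noPop-from-reverse [] τ (unique-↭-oneTo (↭-trans (↭-reverse τ) τ-perm))
                (no123 ∘ subst (Run3 _<_) (reverse-involutive τ) ∘ Run3-reverse) no231
    sorts : west (sσ τ) ≡ oneTo n
    sorts = begin
      west (sσ τ)      ≡⟨ cong west (sσ-reverses τ τ-noPop) ⟩
      west (reverse τ) ≡⟨ sorted-↭-oneTo (west-sorted (reverse τ) no231)
                            (↭-trans (west-↭ (reverse τ)) (↭-trans (↭-reverse τ) τ-perm)) ⟩
      oneTo n          ∎
      where open ≡-Reasoning

mainTheorem17 : (dec : (s : List ℕ) → Dec (Contains s u321)) → (n : ℕ) → 1 ≤ n →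
    (τ : List ℕ) → (InSort u321 dec n τ → InAv (u123 ∷ p132 ∷ []) n τ) × (InAv (u123 ∷ p132 ∷ []) n τ → InSort u321 dec n τ)
mainTheorem17 dec n _ τ = sortable⇒avoiding n τ , avoiding⇒sortable n τ
  where open Stack321 dec
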